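{- Let $\mathcal{A}^{pin}$ and $\mathcal{B}^{pin}$ be pinpointing states (for a fixed consequence-based algorithm) and let $\mathcal{V}$ be a valuation. If $\mathcal{A}^{pin} \rightharpoonup^* \mathcal{B}^{pin}$, then $\mathcal{A}_{\mathcal{V}} \to^* \mathcal{B}_{\mathcal{V}}$.
   Context: A consequence-based algorithm operates on states, which are finite sets of consequences. Its rules are pairs $R=\mathcal{B}_0\to\mathcal{B}_1$, where $\mathcal{B}_0,\mathcal{B}_1$ are finite sets of consequences. A rule $R=\mathcal{B}_0\to\mathcal{B}_1$ is applicable to a state $\mathcal{A}$ if $\mathcal{B}_0\subseteq\mathcal{A}$ and $\mathcal{B}_1\not\subseteq\mathcal{A}$. Its application yields the state $\mathcal{A}\cup\mathcal{B}_1$, written $\mathcal{A}\to_R\mathcal{A}\cup\mathcal{B}_1$ (or $\mathcal{A}\to\mathcal{A}\cup\mathcal{B}_1$). The relation $\to^*$ is the reflexive-transitive closure of $\to$. Monotone Boolean formulae are built from propositional variables and the constants $\top,\bot$ using only $\wedge$ and $\vee$. A valuation is identified with the set of variables it makes true. A pinpointing state $\mathcal{A}^{pin}$ is a set of labelled consequences $\alpha:\varphi_\alpha$, where $\varphi_\alpha$ is a monotone Boolean formula and each consequence carries at most one label. We write $\mathcal{A}$ for its set of underlying consequences. For a set $X$ of consequences, $\mathrm{fm}(X,\mathcal{A}^{pin}):=\bigwedge_{\alpha\in X}\varphi_\alpha$, where $\varphi_\alpha:=\bot$ if $\alpha\notin\mathcal{A}$; the empty conjunction is $\top$. A rule $R=\mathcal{B}_0\to\mathcal{B}_1$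 is pinpointing applicable to $\mathcal{A}^{pin}$ if $\mathrm{fm}(\mathcal{B}_0,\mathcal{A}^{pin})\not\models \mathrm{fm}(\mathcal{B}_1,\mathcal{A}^{pin})$. Its pinpointing application changes, for each $\alpha\in\mathcal{B}_1$, the label $\varphi_\alpha$ to $\varphi_\alpha\vee \mathrm{fm}(\mathcal{B}_0,\mathcal{A}^{pin})$. A consequence of $\mathcal{B}_1$ not yet present (label $\bot$) is thus added with label $\mathrm{fm}(\mathcal{B}_0,\mathcal{A}^{pin})$, and all other labelled consequences are unchanged. This is written $\mathcal{A}^{pin}\rightharpoonup_R\mathcal{B}^{pin}$, and $\rightharpoonup^*$ is the reflexive-transitive closure. For a valuation $\mathcal{V}$, the projection is $\mathcal{A}_{\mathcal{V}}:=\{\alpha\mid \alpha:\varphi_\alpha\in\mathcal{A}^{pin},\ \mathcal{V}\text{ satisfies }\varphi_\alpha\}$. -}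

module Defs where

open import Level using (0ℓ)
open import Data.Bool using (Bool; true; false; T; _∧_; _∨_)
open import Data.Product using (Σ; _×_; _,_; proj₁; proj₂; ∃)
open import Data.List using (List; []; _∷_; _++_; map; filterᵇ)
open import Data.List.Membership.Propositional using (_∈_)
open import Data.List.Relation.Unary.All using (All)
open import Data.List.Relation.Unary.Unique.Propositional using (Unique)
open import Relation.Nullary using (¬_; yes; no)
open import Relation.Binary.Definitions using (DecidableEquality)
open import Relation.Binary.PropositionalEquality using (_≡_)
open import Relation.Binary.Construct.Closure.ReflexiveTransitive using (Star)
open import Function.Bundles using (_⇔_)

data Fm (V : Set) : Set where
  var  : V → Fm V
  ⊤f   : Fm V
  ⊥f   : Fm V
  _∧f_ : Fm V → Fm V → Fm V
  _∨f_ : Fm V → Fm V → Fm V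

-- A valuation: the set of variables made true (as a characteristic function).
Valuation : Set → Set
Valuation V = V → Bool

⟦_⟧ : ∀ {V} → Fm V → Valuation V → Bool
⟦ var x ⟧ 𝓥 = 𝓥 x
⟦ ⊤f ⟧ 𝓥 = true
⟦ ⊥f ⟧ 𝓥 = false
⟦ φ ∧f ψ ⟧ 𝓥 = ⟦ φ ⟧ 𝓥 ∧ ⟦ ψ ⟧ 𝓥
⟦ φ ∨f ψ ⟧ 𝓥 = ⟦ φ ⟧ 𝓥 ∨ ⟦ ψ ⟧ 𝓥

_⊨_ : ∀ {V} → Fm V → Fm V → Set
φ ⊨ ψ = ∀ 𝓥 → T (⟦ φ ⟧ 𝓥) → T (⟦ ψ ⟧ 𝓥)

module _ {C : Set} (_≟_ : DecidableEquality C) where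

  -- (classical) states: finite sets of consequences, represented by lists
  State : Set
  State = List C

  _⊆_ : State → State → Set
  X ⊆ Y = All (_∈ Y) X

  _≈_ : State → State → Set
  X ≈ Y = ∀ x → (x ∈ X) ⇔ (x ∈ Y)

  record Rule : Set where
    constructor _⟶_
    field
      B₀ : List C
      B₁ : List C
  open Rule public

  Algorithm : Set₁
  Algorithm = Rule → Set

  Applicable : Rule → State → Set
  Applicable R 𝒜 = (B₀ R ⊆ 𝒜) × ¬ (B₁ R ⊆ 𝒜)

  Step : Algorithm → State → State → Set
  Step Alg 𝒜 ℬ = Σ Rule λ R → Alg R × Applicable R 𝒜 × (ℬ ≈ (𝒜 ++ B₁ R))

  Steps : Algorithm → State → State → Set
  Steps Alg = Star (Step Alg)

  module _ {V : Set} where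

    PinState : Set
    PinState = List (C × Fm V)

    cons : PinState → State
    cons = map proj₁

    WellFormed : PinState → Set
    WellFormed 𝒜 = Unique (cons 𝒜)

    label : PinState → C → Fm V
    label [] α = ⊥f
    label ((β , φ) ∷ 𝒜) α with α ≟ β
    ... | yes _ = φ
    ... | no _  = label 𝒜 α

    fm : List C → PinState → Fm V
    fm [] 𝒜 = ⊤f
    fm (α ∷ X) 𝒜 = label 𝒜 α ∧f fm X 𝒜

    PinApplicable : Rule → PinState → Set
    PinApplicable R 𝒜 = ¬ (fm (B₀ R) 𝒜 ⊨ fm (B₁ R) 𝒜)

    addLabel : C → Fm V → PinState → PinState
    addLabel α ψ [] = (α , ψ) ∷ []
    addLabel α ψ ((β , φ) ∷ 𝒜) with α ≟ β
    ... | yes _ = (β , φ ∨f ψ) ∷ 𝒜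
    ... | no _  = (β , φ) ∷ addLabel α ψ 𝒜

    addLabels : List C → Fm V → PinState → PinState
    addLabels [] ψ 𝒜 = 𝒜
    addLabels (α ∷ X) ψ 𝒜 = addLabels X ψ (addLabel α ψ 𝒜)

    -- pinpointing application of R; ψ = fm(B₀, 𝒜) is computed in the
    -- original state and used for every α ∈ B₁
    applyPin : Rule → PinState → PinState
    applyPin R 𝒜 = addLabels (B₁ R) (fm (B₀ R) 𝒜) 𝒜

    PinStep : Algorithm → PinState → PinState → Set
    PinStep Alg 𝒜 ℬ = Σ Rule λ R → Alg R × PinApplicable R 𝒜 × (ℬ ≡ applyPin R 𝒜)

    PinSteps : Algorithm → PinState → PinState → Set
    PinSteps Alg = Star (PinStep Alg)

    project : Valuation V → PinState → State
    project 𝓥 𝒜 = cons (filterᵇ (λ p → ⟦ proj₂ p ⟧ 𝓥) 𝒜)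

module Submission where

-- Fix a valuation 𝓥.  A consequence x belongs to the projection 𝒜_𝓥 iff
-- 𝓥 satisfies some label attached to x in 𝒜; we name this Boolean
-- `holds 𝒜 x`.  Adding ψ to the label of α changes it to
-- `(x = α ∧ ⟦ψ⟧) ∨ holds 𝒜 x`, so a pinpointing application of B₀ → B₁
-- with ψ = fm(B₀, 𝒜) either leaves the projection unchanged (𝓥 falsifies
-- ψ) or adds exactly B₁ to it (𝓥 satisfies ψ).  In the second case B₀ is
-- already contained in the projection (fm-sound).  Hence every
-- pinpointing step is simulated by zero or one classical steps, up to set
-- equality of states, and induction over the run gives the theorem.

open import Defs
open import Data.Bool using (Bool; true; false; T; _∧_; _∨_)
open import Data.Bool.Properties
  using (T-∧; T-∨; ∧-distribˡ-∨; ∧-distribʳ-∨; ∨-assoc; ∨-comm; ∨-commutativeMonoid)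
open import Algebra.Bundles using (CommutativeMonoid)
open import Algebra.Properties.CommutativeSemigroup
  (CommutativeMonoid.commutativeSemigroup ∨-commutativeMonoid) using (x∙yz≈y∙xz)
open import Data.Product using (Σ; _×_; _,_; proj₁; proj₂)
open import Data.Product.Function.NonDependent.Propositional using (_×-⇔_)
open import Data.Sum using (_⊎_; inj₁; inj₂; [_,_])
open import Data.Sum.Function.Propositional using (_⊎-⇔_)
open import Data.Unit using (tt)
open import Data.List using ([]; _∷_; _++_)
open import Data.List.Relation.Unary.All as All using ([]; _∷_; all?)
open import Data.List.Relation.Unary.Any using (here; there)
open import Data.List.Membership.Propositional using (_∈_)
open import Data.List.Membership.Propositional.Properties using (∈-++⁺ˡ; ∈-++⁻; ++-∈⇔)
open import Relation.Binary.Definitions using (DecidableEquality)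
open import Relation.Binary.PropositionalEquality using (_≡_; refl; cong; module ≡-Reasoning)
open import Relation.Binary.Construct.Closure.ReflexiveTransitive using (ε; _◅_; _◅◅_)
open import Relation.Nullary using (¬_; Dec; yes; no; does; T?)
open import Data.Empty using (⊥-elim)
open import Function.Base using (id; const; _∘_)
open import Function.Bundles using (_⇔_; mk⇔; Equivalence)
open import Function.Properties.Equivalence using (⇔-isEquivalence)
open import Relation.Binary.Structures using (IsEquivalence)

private
  module ⇔ {ℓ} = IsEquivalence (⇔-isEquivalence {ℓ})

T-does : ∀ {P : Set} (d : Dec P) → T (does d) ⇔ P
T-does (yes p) = mk⇔ (const p) (const tt)
T-does (no ¬p) = mk⇔ (λ ()) ¬p

module Classical {C : Set} (_≟_ : DecidableEquality C) where
  open import Data.List.Membership.DecPropositional _≟_ using (_∈?_)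

  ≈-refl : ∀ {X} → _≈_ _≟_ X X
  ≈-refl x = ⇔.refl

  ≈-sym : ∀ {X Y} → _≈_ _≟_ X Y → _≈_ _≟_ Y X
  ≈-sym X≈Y x = ⇔.sym (X≈Y x)

  ≈-trans : ∀ {X Y Z} → _≈_ _≟_ X Y → _≈_ _≟_ Y Z → _≈_ _≟_ X Z
  ≈-trans X≈Y Y≈Z x = ⇔.trans (X≈Y x) (Y≈Z x)

  ++-congˡ-≈ : ∀ {X Y} Z → _≈_ _≟_ X Y → _≈_ _≟_ (X ++ Z) (Y ++ Z)
  ++-congˡ-≈ Z X≈Y x = ⇔.trans ++-∈⇔ (⇔.trans (X≈Y x ⊎-⇔ ⇔.refl) (⇔.sym ++-∈⇔))

  ++-absorb-⊆ : ∀ {X Y} → _⊆_ _≟_ Y X → _≈_ _≟_ X (X ++ Y)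
  ++-absorb-⊆ {X} Y⊆X x = mk⇔ ∈-++⁺ˡ ([ id , All.lookup Y⊆X ] ∘ ∈-++⁻ X)

  fire : (Alg : Algorithm _≟_) (R : Rule _≟_) {X : State _≟_} →
         Alg R → _⊆_ _≟_ (B₀ R) X →
         Σ (State _≟_) λ X′ → Steps _≟_ Alg X X′ × _≈_ _≟_ X′ (X ++ B₁ R)
  fire Alg R {X} alg B₀⊆X with all? (_∈? X) (B₁ R)
  ... | yes B₁⊆X = X , ε , ++-absorb-⊆ B₁⊆X
  ... | no  B₁⊈X = X ++ B₁ R , (R , alg , (B₀⊆X , B₁⊈X) , ≈-refl) ◅ ε , ≈-refl

module Projection {C V : Set} (_≟_ : DecidableEquality C) (𝓥 : Valuation V) where
  open import Data.List.Membership.DecPropositional _≟_ using (_∈?_)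

  private
    P : PinState _≟_ {V} → State _≟_
    P = project _≟_ 𝓥

  holds : PinState _≟_ {V} → C → Bool
  holds []            x = false
  holds ((β , φ) ∷ 𝒜) x = (does (x ≟ β) ∧ ⟦ φ ⟧ 𝓥) ∨ holds 𝒜 x

  T-holds-∷ : ∀ β φ 𝒜 x →
              T (holds ((β , φ) ∷ 𝒜) x) ⇔ ((x ≡ β × T (⟦ φ ⟧ 𝓥)) ⊎ T (holds 𝒜 x))
  T-holds-∷ β φ 𝒜 x = ⇔.trans T-∨ (⇔.trans T-∧ (T-does (x ≟ β) ×-⇔ ⇔.refl) ⊎-⇔ ⇔.refl)

  ∈-project-∷ : ∀ β φ 𝒜 x →
                x ∈ P ((β , φ) ∷ 𝒜) ⇔ ((x ≡ β × T (⟦ φ ⟧ 𝓥)) ⊎ x ∈ P 𝒜)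
  ∈-project-∷ β φ 𝒜 x with ⟦ φ ⟧ 𝓥
  ... | true  = mk⇔ (λ { (here x≡β) → inj₁ (x≡β , tt) ; (there m) → inj₂ m })
                    [ (λ (x≡β , _) → here x≡β) , there ]
  ... | false = mk⇔ inj₂ [ (λ ()) ∘ proj₂ , id ]

  ∈-project⇔holds : ∀ 𝒜 x → x ∈ P 𝒜 ⇔ T (holds 𝒜 x)
  ∈-project⇔holds []            x = mk⇔ (λ ()) (λ ())
  ∈-project⇔holds ((β , φ) ∷ 𝒜) x =
    ⇔.trans (∈-project-∷ β φ 𝒜 x)
            (⇔.trans (⇔.refl ⊎-⇔ ∈-project⇔holds 𝒜 x) (⇔.sym (T-holds-∷ β φ 𝒜 x)))

  label-sound : ∀ 𝒜 α → T (⟦ label _≟_ 𝒜 α ⟧ 𝓥) → T (holds 𝒜 α)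
  label-sound ((β , φ) ∷ 𝒜) α sat with α ≟ β
  ... | yes _ = Equivalence.from T-∨ (inj₁ sat)
  ... | no  _ = label-sound 𝒜 α sat

  fm-sound : ∀ X 𝒜 → T (⟦ fm _≟_ X 𝒜 ⟧ 𝓥) → _⊆_ _≟_ X (P 𝒜)
  fm-sound []      𝒜 _   = []
  fm-sound (α ∷ X) 𝒜 sat =
    Equivalence.from (∈-project⇔holds 𝒜 α) (label-sound 𝒜 α (proj₁ sat′)) ∷ fm-sound X 𝒜 (proj₂ sat′)
    where sat′ = Equivalence.to T-∧ sat

  holds-addLabel : ∀ α ψ 𝒜 x →
                   holds (addLabel _≟_ α ψ 𝒜) x ≡ (does (x ≟ α) ∧ ⟦ ψ ⟧ 𝓥) ∨ holds 𝒜 x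
  holds-addLabel α ψ []            x = refl
  holds-addLabel α ψ ((β , φ) ∷ 𝒜) x with α ≟ β
  ... | yes refl = begin
    (e ∧ (⟦ φ ⟧ 𝓥 ∨ ⟦ ψ ⟧ 𝓥)) ∨ h         ≡⟨ cong (_∨ h) (∧-distribˡ-∨ e (⟦ φ ⟧ 𝓥) (⟦ ψ ⟧ 𝓥)) ⟩
    ((e ∧ ⟦ φ ⟧ 𝓥) ∨ (e ∧ ⟦ ψ ⟧ 𝓥)) ∨ h   ≡⟨ cong (_∨ h) (∨-comm (e ∧ ⟦ φ ⟧ 𝓥) (e ∧ ⟦ ψ ⟧ 𝓥)) ⟩
    ((e ∧ ⟦ ψ ⟧ 𝓥) ∨ (e ∧ ⟦ φ ⟧ 𝓥)) ∨ h   ≡⟨ ∨-assoc (e ∧ ⟦ ψ ⟧ 𝓥) (e ∧ ⟦ φ ⟧ 𝓥) h ⟩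
    (e ∧ ⟦ ψ ⟧ 𝓥) ∨ ((e ∧ ⟦ φ ⟧ 𝓥) ∨ h)   ∎
    where open ≡-Reasoning
          e = does (x ≟ α)
          h = holds 𝒜 x
  ... | no _ = begin
    (d ∧ ⟦ φ ⟧ 𝓥) ∨ holds (addLabel _≟_ α ψ 𝒜) x
      ≡⟨ cong ((d ∧ ⟦ φ ⟧ 𝓥) ∨_) (holds-addLabel α ψ 𝒜 x) ⟩
    (d ∧ ⟦ φ ⟧ 𝓥) ∨ ((e ∧ ⟦ ψ ⟧ 𝓥) ∨ h)   ≡⟨ x∙yz≈y∙xz (d ∧ ⟦ φ ⟧ 𝓥) (e ∧ ⟦ ψ ⟧ 𝓥) h ⟩
    (e ∧ ⟦ ψ ⟧ 𝓥) ∨ ((d ∧ ⟦ φ ⟧ 𝓥) ∨ h)   ∎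
    where open ≡-Reasoning
          d = does (x ≟ β)
          e = does (x ≟ α)
          h = holds 𝒜 x

  holds-addLabels : ∀ X ψ 𝒜 x →
                    holds (addLabels _≟_ X ψ 𝒜) x ≡ (does (x ∈? X) ∧ ⟦ ψ ⟧ 𝓥) ∨ holds 𝒜 x
  holds-addLabels []      ψ 𝒜 x = refl
  holds-addLabels (α ∷ X) ψ 𝒜 x = begin
    holds (addLabels _≟_ X ψ (addLabel _≟_ α ψ 𝒜)) x
      ≡⟨ holds-addLabels X ψ (addLabel _≟_ α ψ 𝒜) x ⟩
    (m ∧ s) ∨ holds (addLabel _≟_ α ψ 𝒜) x
      ≡⟨ cong ((m ∧ s) ∨_) (holds-addLabel α ψ 𝒜 x) ⟩
    (m ∧ s) ∨ ((e ∧ s) ∨ h)    ≡⟨ x∙yz≈y∙xz (m ∧ s) (e ∧ s) h ⟩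
    (e ∧ s) ∨ ((m ∧ s) ∨ h)    ≡⟨ ∨-assoc (e ∧ s) (m ∧ s) h ⟨
    ((e ∧ s) ∨ (m ∧ s)) ∨ h    ≡⟨ cong (_∨ h) (∧-distribʳ-∨ s e m) ⟨
    ((e ∨ m) ∧ s) ∨ h          ∎
    where open ≡-Reasoning
          e = does (x ≟ α)
          m = does (x ∈? X)
          s = ⟦ ψ ⟧ 𝓥
          h = holds 𝒜 x

  ∈-project-addLabels : ∀ X ψ 𝒜 x →
                        x ∈ P (addLabels _≟_ X ψ 𝒜) ⇔ ((x ∈ X × T (⟦ ψ ⟧ 𝓥)) ⊎ x ∈ P 𝒜)
  ∈-project-addLabels X ψ 𝒜 x =
    ⇔.trans (∈-project⇔holds (addLabels _≟_ X ψ 𝒜) x)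
    (⇔.trans (⇔.reflexive (cong T (holds-addLabels X ψ 𝒜 x)))
    (⇔.trans T-∨
      (⇔.trans T-∧ (T-does (x ∈? X) ×-⇔ ⇔.refl) ⊎-⇔ ⇔.sym (∈-project⇔holds 𝒜 x))))

  project-addLabels-unsat : ∀ X ψ 𝒜 → ¬ T (⟦ ψ ⟧ 𝓥) →
                            _≈_ _≟_ (P (addLabels _≟_ X ψ 𝒜)) (P 𝒜)
  project-addLabels-unsat X ψ 𝒜 unsat x = ⇔.trans (∈-project-addLabels X ψ 𝒜 x)
    (mk⇔ [ ⊥-elim ∘ unsat ∘ proj₂ , id ] inj₂)

  project-addLabels-sat : ∀ X ψ 𝒜 → T (⟦ ψ ⟧ 𝓥) →
                          _≈_ _≟_ (P (addLabels _≟_ X ψ 𝒜)) (P 𝒜 ++ X)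
  project-addLabels-sat X ψ 𝒜 sat x = ⇔.trans (∈-project-addLabels X ψ 𝒜 x)
    (⇔.trans (mk⇔ [ inj₂ ∘ proj₁ , inj₁ ] [ inj₂ , (λ x∈X → inj₁ (x∈X , sat)) ]) (⇔.sym ++-∈⇔))

module Simulation {C V : Set} (_≟_ : DecidableEquality C) (𝓥 : Valuation V)
                  (Alg : Algorithm _≟_) where
  open Classical _≟_
  open Projection _≟_ 𝓥

  Simulates : PinState _≟_ {V} → State _≟_ → Set
  Simulates ℬ Q = Σ (State _≟_) λ Q′ → Steps _≟_ Alg Q Q′ × _≈_ _≟_ Q′ (project _≟_ 𝓥 ℬ)

  -- One pinpointing step with ψ = fm(B₀, 𝒜) is simulated by firing R when
  -- 𝓥 satisfies ψ (its premises are then in the projection) and by doing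
  -- nothing otherwise.
  simulate-step : ∀ {𝒜 ℬ Q} → _≈_ _≟_ Q (project _≟_ 𝓥 𝒜) →
                  PinStep _≟_ Alg 𝒜 ℬ → Simulates ℬ Q
  simulate-step {𝒜} {Q = Q} Q≈𝒜 (R , alg , _ , refl) with T? (⟦ fm _≟_ (B₀ R) 𝒜 ⟧ 𝓥)
  ... | no unsat =
    Q , ε , ≈-trans Q≈𝒜 (≈-sym (project-addLabels-unsat (B₁ R) _ 𝒜 unsat))
  ... | yes sat with fire Alg R alg (All.map (Equivalence.from (Q≈𝒜 _)) (fm-sound (B₀ R) 𝒜 sat))
  ...   | Q′ , steps , Q′≈Q∪B₁ =
    Q′ , steps , ≈-trans Q′≈Q∪B₁ (≈-trans (++-congˡ-≈ (B₁ R) Q≈𝒜)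
                                          (≈-sym (project-addLabels-sat (B₁ R) _ 𝒜 sat)))

  simulate : ∀ {𝒜 ℬ Q} → _≈_ _≟_ Q (project _≟_ 𝓥 𝒜) →
             PinSteps _≟_ Alg 𝒜 ℬ → Simulates ℬ Q
  simulate {Q = Q} Q≈𝒜 ε = Q , ε , Q≈𝒜
  simulate Q≈𝒜 (step ◅ run) with simulate-step Q≈𝒜 step
  ... | Q′ , steps , Q′≈ with simulate Q′≈ run
  ...   | Q″ , steps′ , Q″≈ = Q″ , steps ◅◅ steps′ , Q″≈

-- Projections of pinpointing runs are classical runs (up to set equality
-- of the final state).
lemma1 : {C V : Set} (_≟_ : DecidableEquality C) (Alg : Algorithm _≟_)
         (𝒜 ℬ : PinState _≟_ {V}) (𝓥 : Valuation V) →
         WellFormed _≟_ 𝒜 →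
         PinSteps _≟_ Alg 𝒜 ℬ →
         Σ (State _≟_) λ ℬ′ →
           Steps _≟_ Alg (project _≟_ 𝓥 𝒜) ℬ′ × _≈_ _≟_ ℬ′ (project _≟_ 𝓥 ℬ)
lemma1 _≟_ Alg 𝒜 ℬ 𝓥 _ run = Simulation.simulate _≟_ 𝓥 Alg (Classical.≈-refl _≟_) run
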